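{- Let $n\ge 4$ be an integer and let $\lambda=\langle n,n-1,n-2,n-3\rangle$. Then the rank-generating function $F_{\lambda}(q)$ is unimodal.
   Context: For a partition with distinct parts $\lambda=\langle \lambda_1,\dots,\lambda_b\rangle$ (so $\lambda_1>\lambda_2>\dots>\lambda_b\ge 1$), a partition $\mu$ is contained in the shifted Ferrers shape $\lambda$ if $\mu=\langle\mu_1,\dots,\mu_k\rangle$ has distinct parts, $k\le b$, and $\mu_i\le\lambda_i$ for all $i\le k$ (the empty partition is included). The rank-generating function is $F_{\lambda}(q)=\sum_{\mu} q^{|\mu|}$, the sum over all such $\mu$, where $|\mu|$ is the sum of the parts of $\mu$. A polynomial $\sum_i c_iq^i$ is unimodal if its coefficient sequence never strictly increases after a strict decrease, i.e. there is an index $m$ with $c_0\le c_1\le\dots\le c_m\ge c_{m+1}\ge\dots$. -}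

module Defs where

open import Data.Nat using (ℕ; zero; suc; _+_; _≤_; _<_; _>_; _≤?_; _<?_)
open import Data.Nat.ListAction using (sum)
open import Data.List using (List; []; _∷_; length; map; concatMap; filter; upTo; applyUpTo)
open import Data.Product using (_×_; _,_; ∃-syntax)
open import Data.Unit using (⊤; tt)
open import Data.Empty using (⊥)
open import Relation.Nullary using (Dec; yes; no)
open import Relation.Nullary.Decidable using (_×-dec_)
open import Relation.Binary.PropositionalEquality using (_≡_)
open import Data.Nat using (_≟_)

DistinctParts : List ℕ → Set
DistinctParts []           = ⊤
DistinctParts (x ∷ [])     = 1 ≤ x
DistinctParts (x ∷ y ∷ xs) = (x > y) × DistinctParts (y ∷ xs)

distinctParts? : (xs : List ℕ) → Dec (DistinctParts xs)
distinctParts? []           = yes tt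
distinctParts? (x ∷ [])     = 1 ≤? x
distinctParts? (x ∷ y ∷ xs) = (y <? x) ×-dec distinctParts? (y ∷ xs)

FitsUnder : List ℕ → List ℕ → Set
FitsUnder []       _        = ⊤
FitsUnder (m ∷ μ)  []       = ⊥
FitsUnder (m ∷ μ)  (l ∷ λ') = (m ≤ l) × FitsUnder μ λ'

fitsUnder? : (μ λ' : List ℕ) → Dec (FitsUnder μ λ')
fitsUnder? []      _        = yes tt
fitsUnder? (m ∷ μ) []       = no (λ ())
fitsUnder? (m ∷ μ) (l ∷ λ') = (m ≤? l) ×-dec fitsUnder? μ λ'

-- μ is contained in the shifted Ferrers shape λ.
ContainedIn : List ℕ → List ℕ → Set
ContainedIn λ' μ = DistinctParts μ × FitsUnder μ λ'

containedIn? : (λ' μ : List ℕ) → Dec (ContainedIn λ' μ)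
containedIn? λ' μ = distinctParts? μ ×-dec fitsUnder? μ λ'

-- All lists of length ≤ b with entries in {0,…,N} (a finite search space
-- containing every μ contained in λ, when N ≥ λ₁ and b = length λ).
listsUpTo : ℕ → ℕ → List (List ℕ)
listsUpTo zero    N = [] ∷ []
listsUpTo (suc b) N = [] ∷ concatMap (λ x → map (x ∷_) (listsUpTo b N)) (upTo (suc N))

maxPart : List ℕ → ℕ
maxPart []       = 0
maxPart (x ∷ _)  = x

shapesIn : List ℕ → List (List ℕ)
shapesIn λ' = filter (containedIn? λ') (listsUpTo (length λ') (maxPart λ'))

-- Coefficient of q^k in the rank-generating function
-- F_λ(q) = Σ_{μ ⊆ λ} q^{|μ|}: the number of μ contained in λ with |μ| = k.
rankCoeff : List ℕ → ℕ → ℕ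
rankCoeff λ' k = length (filter (λ μ → sum μ ≟ k) (shapesIn λ'))

-- A polynomial with coefficient sequence c (c i = coefficient of q^i,
-- zero beyond the degree) is unimodal: c₀ ≤ … ≤ c_m ≥ c_{m+1} ≥ …
Unimodal : (ℕ → ℕ) → Set
Unimodal c = ∃[ m ] (((i : ℕ) → i < m → c i ≤ c (suc i))
                    × ((i : ℕ) → m ≤ i → c (suc i) ≤ c i))

module Submission where

-- A shape contained in ⟨n, n−1, n−2, n−3⟩ is a strictly decreasing list of at most four positive parts,
-- the largest at most n (the bounds μᵢ ≤ n + 1 − i then follow from strictness); so F_λ counts the subsets
-- of {1, …, n} of size at most 4 by their sums. For n ≥ 5 the coefficients rise up to q^(2n) and fall
-- afterwards, each step being an explicit injection between consecutive levels. Rising (s < 2n): raise the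
-- largest part by one. This never yields a shape whose two largest parts are consecutive, and the shapes
-- that cannot be raised (largest part n) are sent injectively to such shapes by encoding their third and
-- fourth parts. Falling (s ≥ 2n): a shape of size s + 1 has at least three parts; lower the fourth part by
-- one (dropping it at 0). This never yields a shape whose third and fourth parts are consecutive (an absent
-- fourth part read as 0), and the three-part shapes are sent injectively to such shapes. For n = 4 the mode
-- is 3 and the finitely many remaining steps are checked by computation.

open import Defs
open import Data.Nat using (ℕ; zero; suc; pred; _+_; _*_; _∸_; _≤_; _<_; z≤n; s≤s; _≟_; _<?_)
open import Data.Nat.Properties
open import Data.Nat.DivMod using (_/_; _%_; m≡m%n+[m/n]*n; m%n<n; /-monoˡ-≤)
open import Data.Nat.ListAction using (sum)
open import Data.Nat.Tactic.RingSolver using (solve)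
open import Data.List using (List; []; _∷_; _++_; length; map; concatMap; filter; upTo)
open import Data.List.Properties using (∷-injectiveˡ; ∷-injectiveʳ)
open import Data.List.Membership.Propositional using (_∈_)
open import Data.List.Membership.Propositional.Properties
open import Data.List.Relation.Unary.Any using (here; there)
open import Data.List.Relation.Unary.All as All using (All; lookup; tabulate)
import Data.List.Relation.Unary.AllPairs as AllPairs
open import Data.List.Relation.Unary.Unique.Propositional using (Unique)
import Data.List.Relation.Unary.Unique.Propositional.Properties as Unique
open import Data.List.Relation.Binary.Disjoint.Propositional using (Disjoint)
open import Data.Product using (∃-syntax; _×_; _,_; proj₁; proj₂; swap)
open import Data.Sum using (inj₁; inj₂)
open import Data.Unit using (tt)
open import Data.Empty using (⊥; ⊥-elim)
open import Relation.Nullary using (yes; no; ¬_)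
open import Relation.Binary.PropositionalEquality

m+m≤n+n⇒m≤n : ∀ {m n} → m + m ≤ n + n → m ≤ n
m+m≤n+n⇒m≤n h = ≮⇒≥ (λ n<m → <⇒≱ (+-mono-< n<m n<m) h)

m+m≤1+n+n⇒m≤n : ∀ {m n} → m + m ≤ suc (n + n) → m ≤ n
m+m≤1+n+n⇒m≤n {m} {n} h =
  ≮⇒≥ λ n<m → <⇒≱ (≤-trans (s≤s (≤-reflexive (sym (+-suc n n)))) (+-mono-≤ n<m n<m)) h

m+m≡n+n⇒m≡n : ∀ {m n} → m + m ≡ n + n → m ≡ n
m+m≡n+n⇒m≡n h = ≤-antisym (m+m≤n+n⇒m≤n (≤-reflexive h)) (m+m≤n+n⇒m≤n (≤-reflexive (sym h)))

sums⇒≡ : ∀ {p q p′ q′} → p + q′ ≡ p′ + q → p + q ≡ p′ + q′ → p ≡ p′ × q ≡ q′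
sums⇒≡ {p} {q} {p′} {q′} cross same = p≡p′ , +-cancelˡ-≡ p _ _ (trans same (cong (_+ q′) (sym p≡p′)))
  where
  p≡p′ : p ≡ p′
  p≡p′ = m+m≡n+n⇒m≡n (+-cancelʳ-≡ (q + q′) _ _ (begin
    p + p + (q + q′)          ≡⟨ solve (p ∷ q ∷ q′ ∷ []) ⟩
    (p + q′) + (p + q)        ≡⟨ cong₂ _+_ cross same ⟩
    (p′ + q) + (p′ + q′)      ≡⟨ solve (p′ ∷ q ∷ q′ ∷ []) ⟩
    p′ + p′ + (q + q′)        ∎))
    where open ≡-Reasoning

m+m<n+n⇒m<n : ∀ {m n} → m + m < n + n → m < n
m+m<n+n⇒m<n h = ≰⇒> (λ n≤m → <⇒≱ h (+-mono-≤ n≤m n≤m))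

+-cancel-difference : ∀ {x N p q p′ q′} → x + p ≡ N + q → x + p′ ≡ N + q′ → p + q′ ≡ p′ + q
+-cancel-difference {x} {N} {p} {q} {p′} {q′} x+p≡ x+p′≡ = +-cancelˡ-≡ x _ _ (begin
  x + (p + q′)   ≡⟨ +-assoc x p q′ ⟨
  x + p + q′     ≡⟨ cong (_+ q′) x+p≡ ⟩
  N + q + q′     ≡⟨ solve (N ∷ q ∷ q′ ∷ []) ⟩
  N + q′ + q     ≡⟨ cong (_+ q) x+p′≡ ⟨
  x + p′ + q     ≡⟨ +-assoc x p′ q ⟩
  x + (p′ + q)   ∎)
  where open ≡-Reasoning

-- Comparing lengths by injections

∈-++-∷⇒∈-++ : ∀ {A : Set} {x y : A} (ys zs : List A) → x ∈ ys ++ y ∷ zs → x ≢ y → x ∈ ys ++ zs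
∈-++-∷⇒∈-++ []       zs (here x≡y)  x≢y = ⊥-elim (x≢y x≡y)
∈-++-∷⇒∈-++ []       zs (there x∈)  _   = x∈
∈-++-∷⇒∈-++ (_ ∷ ys) zs (here x≡z)  _   = here x≡z
∈-++-∷⇒∈-++ (_ ∷ ys) zs (there x∈)  x≢y = there (∈-++-∷⇒∈-++ ys zs x∈ x≢y)

length-++-∷ : ∀ {A : Set} (ys zs : List A) {y : A} → length (ys ++ y ∷ zs) ≡ suc (length (ys ++ zs))
length-++-∷ []       zs = refl
length-++-∷ (_ ∷ ys) zs = cong suc (length-++-∷ ys zs)

length-≤-injection : ∀ {A B : Set} (f : A → B) (xs : List A) (ys : List B) → Unique xs →
  (∀ {x} → x ∈ xs → f x ∈ ys) →
  (∀ {x x′} → x ∈ xs → x′ ∈ xs → f x ≡ f x′ → x ≡ x′) →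
  length xs ≤ length ys
length-≤-injection f []       ys _            _    _   = z≤n
length-≤-injection f (x ∷ xs) ys (x∉ AllPairs.∷ uniq) into inj
  with ys₁ , ys₂ , refl ← ∈-∃++ (into (here refl)) =
  subst (suc (length xs) ≤_) (sym (length-++-∷ ys₁ ys₂))
    (s≤s (length-≤-injection f xs (ys₁ ++ ys₂) uniq into′ (λ p q → inj (there p) (there q))))
  where
  into′ : ∀ {x′} → x′ ∈ xs → f x′ ∈ ys₁ ++ ys₂
  into′ x′∈ = ∈-++-∷⇒∈-++ ys₁ ys₂ (into (there x′∈))
                (λ fx′≡fx → lookup x∉ x′∈ (sym (inj (there x′∈) (here refl) fx′≡fx)))

prefixed : ℕ → ℕ → List ℕ → List (List ℕ)
prefixed b N = concatMap (λ x → map (x ∷_) (listsUpTo b N))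

∈-prefixed⁻ : ∀ {b N μ} xs → μ ∈ prefixed b N xs → ∃[ x ] ∃[ ν ] (μ ≡ x ∷ ν × x ∈ xs)
∈-prefixed⁻ {b} {N} (x ∷ xs) μ∈ with ∈-++⁻ (map (x ∷_) (listsUpTo b N)) μ∈
... | inj₁ μ∈x∷ with ν , _ , eq ← ∈-map⁻ (x ∷_) μ∈x∷ = x , ν , eq , here refl
... | inj₂ μ∈xs with y , ν , eq , y∈ ← ∈-prefixed⁻ xs μ∈xs = y , ν , eq , there y∈

prefixed-unique : ∀ b N xs → Unique xs → Unique (listsUpTo b N) → Unique (prefixed b N xs)
prefixed-unique b N []       _             _    = AllPairs.[]
prefixed-unique b N (x ∷ xs) (x∉ AllPairs.∷ uniq) uniqL =
  Unique.++⁺ (Unique.map⁺ ∷-injectiveʳ uniqL) (prefixed-unique b N xs uniq uniqL) disjoint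
  where
  disjoint : Disjoint (map (x ∷_) (listsUpTo b N)) (prefixed b N xs)
  disjoint (p , q) with ∈-map⁻ (x ∷_) p | ∈-prefixed⁻ xs q
  ... | _ , _ , refl | _ , _ , refl , y∈ = lookup x∉ y∈ refl

listsUpTo-unique : ∀ b N → Unique (listsUpTo b N)
listsUpTo-unique zero    N = All.[] AllPairs.∷ AllPairs.[]
listsUpTo-unique (suc b) N =
  tabulate []∉ AllPairs.∷ prefixed-unique b N (upTo (suc N)) (Unique.upTo⁺ (suc N)) (listsUpTo-unique b N)
  where
  []∉ : ∀ {μ} → μ ∈ prefixed b N (upTo (suc N)) → [] ≢ μ
  []∉ μ∈ with _ , _ , refl , _ ← ∈-prefixed⁻ (upTo (suc N)) μ∈ = λ ()

∈-listsUpTo : ∀ b N {μ} → length μ ≤ b → All (_≤ N) μ → μ ∈ listsUpTo b N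
∈-listsUpTo zero    N {[]}    _       _            = here refl
∈-listsUpTo (suc b) N {[]}    _       _            = here refl
∈-listsUpTo (suc b) N {x ∷ μ} (s≤s ∣μ∣≤b) (x≤N All.∷ μ≤N) =
  there (∈-prefixed (upTo (suc N)) (∈-upTo⁺ (s≤s x≤N)))
  where
  ∈-prefixed : ∀ xs → x ∈ xs → x ∷ μ ∈ prefixed b N xs
  ∈-prefixed (_ ∷ _)  (here refl) = ∈-++⁺ˡ (∈-map⁺ (x ∷_) (∈-listsUpTo b N ∣μ∣≤b μ≤N))
  ∈-prefixed (y ∷ xs) (there x∈)  = ∈-++⁺ʳ (map (y ∷_) (listsUpTo b N)) (∈-prefixed xs x∈)

fitsUnder-bounded : ∀ {N} μ λ′ → FitsUnder μ λ′ → All (_≤ N) λ′ → All (_≤ N) μ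
fitsUnder-bounded []      _        _            _           = All.[]
fitsUnder-bounded (_ ∷ μ) (_ ∷ λ′) (m≤l , fits) (l≤N All.∷ λ≤N) =
  ≤-trans m≤l l≤N All.∷ fitsUnder-bounded μ λ′ fits λ≤N

staircase : ℕ → List ℕ
staircase n = n ∷ n ∸ 1 ∷ n ∸ 2 ∷ n ∸ 3 ∷ []

m<k≤n∸i⇒m≤n∸1+i : ∀ n i {m k} → m < k → k ≤ n ∸ i → m ≤ n ∸ suc i
m<k≤n∸i⇒m≤n∸1+i n i {m} m<k k≤n∸i =
  subst (m ≤_) (pred[m∸n]≡m∸[1+n] n i) (<⇒≤pred (<-≤-trans m<k k≤n∸i))

data Shape (n : ℕ) : List ℕ → Set where
  shape₀ : Shape n []
  shape₁ : ∀ {a} → 1 ≤ a → a ≤ n → Shape n (a ∷ [])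
  shape₂ : ∀ {a b} → 1 ≤ b → b < a → a ≤ n → Shape n (a ∷ b ∷ [])
  shape₃ : ∀ {a b c} → 1 ≤ c → c < b → b < a → a ≤ n → Shape n (a ∷ b ∷ c ∷ [])
  shape₄ : ∀ {a b c d} → 1 ≤ d → d < c → c < b → b < a → a ≤ n → Shape n (a ∷ b ∷ c ∷ d ∷ [])

containedIn⇒Shape : ∀ {n} μ → ContainedIn (staircase n) μ → Shape n μ
containedIn⇒Shape []                      _                                   = shape₀
containedIn⇒Shape (_ ∷ [])                (a≥1 , a≤n , _)                     = shape₁ a≥1 a≤n
containedIn⇒Shape (_ ∷ _ ∷ [])            ((b<a , b≥1) , a≤n , _)             = shape₂ b≥1 b<a a≤n
containedIn⇒Shape (_ ∷ _ ∷ _ ∷ [])        ((b<a , c<b , c≥1) , a≤n , _)       = shape₃ c≥1 c<b b<a a≤n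
containedIn⇒Shape (_ ∷ _ ∷ _ ∷ _ ∷ [])    ((b<a , c<b , d<c , d≥1) , a≤n , _) = shape₄ d≥1 d<c c<b b<a a≤n
containedIn⇒Shape (_ ∷ _ ∷ _ ∷ _ ∷ _ ∷ _) (_ , _ , _ , _ , _ , ())

second≤ : ∀ {n a b} → b < a → a ≤ n → b ≤ n ∸ 1
second≤ {n} b<a a≤n = m<k≤n∸i⇒m≤n∸1+i n 0 b<a a≤n

third≤ : ∀ {n a b c} → c < b → b < a → a ≤ n → c ≤ n ∸ 2
third≤ {n} c<b b<a a≤n = m<k≤n∸i⇒m≤n∸1+i n 1 c<b (second≤ b<a a≤n)

fourth≤ : ∀ {n a b c d} → d < c → c < b → b < a → a ≤ n → d ≤ n ∸ 3
fourth≤ {n} d<c c<b b<a a≤n = m<k≤n∸i⇒m≤n∸1+i n 2 d<c (third≤ c<b b<a a≤n)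

Shape⇒containedIn : ∀ {n μ} → Shape n μ → ContainedIn (staircase n) μ
Shape⇒containedIn shape₀                   = tt , tt
Shape⇒containedIn (shape₁ a≥1 a≤n)         = a≥1 , a≤n , tt
Shape⇒containedIn (shape₂ b≥1 b<a a≤n)     = (b<a , b≥1) , a≤n , second≤ b<a a≤n , tt
Shape⇒containedIn (shape₃ c≥1 c<b b<a a≤n) =
  (b<a , c<b , c≥1) , a≤n , second≤ b<a a≤n , third≤ c<b b<a a≤n , tt
Shape⇒containedIn (shape₄ d≥1 d<c c<b b<a a≤n) =
  (b<a , c<b , d<c , d≥1) , a≤n , second≤ b<a a≤n , third≤ c<b b<a a≤n , fourth≤ d<c c<b b<a a≤n , tt

Shape-length≤4 : ∀ {n μ} → Shape n μ → length μ ≤ 4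
Shape-length≤4 shape₀             = z≤n
Shape-length≤4 (shape₁ _ _)       = s≤s z≤n
Shape-length≤4 (shape₂ _ _ _)     = s≤s (s≤s z≤n)
Shape-length≤4 (shape₃ _ _ _ _)   = s≤s (s≤s (s≤s z≤n))
Shape-length≤4 (shape₄ _ _ _ _ _) = ≤-refl

Shape-bounded : ∀ {n μ} → Shape n μ → All (_≤ n) μ
Shape-bounded {n} sh = fitsUnder-bounded _ _ (proj₂ (Shape⇒containedIn sh))
  (≤-refl All.∷ m∸n≤m n 1 All.∷ m∸n≤m n 2 All.∷ m∸n≤m n 3 All.∷ All.[])

-- Opaque, so that n and s are inferred from `μ ∈ level n s` by unification.
opaque
  level : ℕ → ℕ → List (List ℕ)
  level n s = filter (λ μ → sum μ ≟ s) (shapesIn (staircase n))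

  rankCoeff-staircase : ∀ n s → rankCoeff (staircase n) s ≡ length (level n s)
  rankCoeff-staircase n s = refl

  level-unique : ∀ n s → Unique (level n s)
  level-unique n s =
    Unique.filter⁺ (λ μ → sum μ ≟ s) (Unique.filter⁺ (containedIn? (staircase n)) (listsUpTo-unique 4 n))

  ∈-level⁻ : ∀ {n s μ} → μ ∈ level n s → Shape n μ × sum μ ≡ s
  ∈-level⁻ {n} {s} {μ} μ∈
    with μ∈shapes , sum≡s ← ∈-filter⁻ (λ μ → sum μ ≟ s) {xs = shapesIn (staircase n)} μ∈ =
    containedIn⇒Shape μ (proj₂ (∈-filter⁻ (containedIn? (staircase n)) {xs = listsUpTo 4 n} μ∈shapes)) , sum≡s

  ∈-level⁺ : ∀ {n s μ} → Shape n μ → sum μ ≡ s → μ ∈ level n s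
  ∈-level⁺ {n} {s} sh sum≡s =
    ∈-filter⁺ (λ μ → sum μ ≟ s)
      (∈-filter⁺ (containedIn? (staircase n)) (∈-listsUpTo 4 n (Shape-length≤4 sh) (Shape-bounded sh))
                 (Shape⇒containedIn sh))
      sum≡s

-- Rising: raising the largest part

head-≥1 : ∀ {n a r} → Shape n (a ∷ r) → 1 ≤ a
head-≥1 (shape₁ a≥1 _)               = a≥1
head-≥1 (shape₂ b≥1 b<a _)           = ≤-trans b≥1 (<⇒≤ b<a)
head-≥1 (shape₃ c≥1 c<b b<a _)       = ≤-trans c≥1 (<⇒≤ (<-trans c<b b<a))
head-≥1 (shape₄ d≥1 d<c c<b b<a _)   = ≤-trans d≥1 (<⇒≤ (<-trans d<c (<-trans c<b b<a)))

head-≤ : ∀ {n a r} → Shape n (a ∷ r) → a ≤ n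
head-≤ (shape₁ _ a≤n)         = a≤n
head-≤ (shape₂ _ _ a≤n)       = a≤n
head-≤ (shape₃ _ _ _ a≤n)     = a≤n
head-≤ (shape₄ _ _ _ _ a≤n)   = a≤n

raise-head : ∀ {n a r} → Shape n (a ∷ r) → a < n → Shape n (suc a ∷ r)
raise-head (shape₁ _ _)               a<n = shape₁ (s≤s z≤n) a<n
raise-head (shape₂ b≥1 b<a _)         a<n = shape₂ b≥1 (m<n⇒m<1+n b<a) a<n
raise-head (shape₃ c≥1 c<b b<a _)     a<n = shape₃ c≥1 c<b (m<n⇒m<1+n b<a) a<n
raise-head (shape₄ d≥1 d<c c<b b<a _) a<n = shape₄ d≥1 d<c c<b (m<n⇒m<1+n b<a) a<n

TopConsecutive : List ℕ → Set
TopConsecutive (a ∷ b ∷ _) = a ≡ suc b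
TopConsecutive _           = ⊥

raised-¬top : ∀ {n a r} → Shape n (a ∷ r) → ¬ TopConsecutive (suc a ∷ r)
raised-¬top (shape₁ _ _)           ()
raised-¬top (shape₂ _ b<a _)       a≡b = <-irrefl (sym (suc-injective a≡b)) b<a
raised-¬top (shape₃ _ _ b<a _)     a≡b = <-irrefl (sym (suc-injective a≡b)) b<a
raised-¬top (shape₄ _ _ _ b<a _)   a≡b = <-irrefl (sym (suc-injective a≡b)) b<a

record FullToTopConsecutive (n s : ℕ) : Set where
  field
    ψ           : List ℕ → List ℕ
    ψ-∈         : ∀ {r} → n ∷ r ∈ level n s → ψ r ∈ level n (suc s)
    ψ-top       : ∀ r → TopConsecutive (ψ r)
    ψ-injective : ∀ {r r′} → n ∷ r ∈ level n s → n ∷ r′ ∈ level n s → ψ r ≡ ψ r′ → r ≡ r′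

module RaiseHead {n s} (n≥1 : 1 ≤ n) (full : FullToTopConsecutive n s) where
  open FullToTopConsecutive full

  raise : List ℕ → List ℕ
  raise []      = 1 ∷ []
  raise (a ∷ r) with a <? n
  ... | yes _ = suc a ∷ r
  ... | no  _ = ψ r

  head≡n : ∀ {a r} → a ∷ r ∈ level n s → ¬ a < n → a ≡ n
  head≡n μ∈ a≮n = ≤-antisym (head-≤ (proj₁ (∈-level⁻ μ∈))) (≮⇒≥ a≮n)

  full-head : ∀ {a r} → a ∷ r ∈ level n s → ¬ a < n → n ∷ r ∈ level n s
  full-head {r = r} μ∈ a≮n = subst (λ a → a ∷ r ∈ level n s) (head≡n μ∈ a≮n) μ∈

  raise-∈ : ∀ {μ} → μ ∈ level n s → raise μ ∈ level n (suc s)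
  raise-∈ {[]}    μ∈ = ∈-level⁺ (shape₁ ≤-refl n≥1) (cong suc (proj₂ (∈-level⁻ μ∈)))
  raise-∈ {a ∷ r} μ∈ with a <? n | ∈-level⁻ μ∈
  ... | yes a<n | sh , sum≡s = ∈-level⁺ (raise-head sh a<n) (cong suc sum≡s)
  ... | no  a≮n | _          = ψ-∈ (full-head μ∈ a≮n)

  raise-injective : ∀ {μ μ′} → μ ∈ level n s → μ′ ∈ level n s → raise μ ≡ raise μ′ → μ ≡ μ′
  raise-injective {[]}    {[]}     _  _   _ = refl
  raise-injective {[]}    {b ∷ r′} _  μ′∈ eq with b <? n
  ... | yes _   = ⊥-elim (<⇒≢ (head-≥1 (proj₁ (∈-level⁻ μ′∈))) (suc-injective (∷-injectiveˡ eq)))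
  ... | no  b≮n = ⊥-elim (subst TopConsecutive (sym eq) (ψ-top _))
  raise-injective {a ∷ r} {[]}     μ∈ _   eq with a <? n
  ... | yes _   = ⊥-elim (<⇒≢ (head-≥1 (proj₁ (∈-level⁻ μ∈))) (sym (suc-injective (∷-injectiveˡ eq))))
  ... | no  a≮n = ⊥-elim (subst TopConsecutive eq (ψ-top _))
  raise-injective {a ∷ r} {b ∷ r′} μ∈ μ′∈ eq with a <? n | b <? n
  ... | yes _   | yes _   = cong₂ _∷_ (suc-injective (∷-injectiveˡ eq)) (∷-injectiveʳ eq)
  ... | yes _   | no  b≮n =
    ⊥-elim (raised-¬top (proj₁ (∈-level⁻ μ∈)) (subst TopConsecutive (sym eq) (ψ-top _)))
  ... | no  a≮n | yes _   =
    ⊥-elim (raised-¬top (proj₁ (∈-level⁻ μ′∈)) (subst TopConsecutive eq (ψ-top _)))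
  ... | no  a≮n | no  b≮n =
    cong₂ _∷_ (trans (head≡n μ∈ a≮n) (sym (head≡n μ′∈ b≮n)))
              (ψ-injective (full-head μ∈ a≮n) (full-head μ′∈ b≮n) eq)

level-≤-level-suc : ∀ {n s} → 1 ≤ n → FullToTopConsecutive n s →
  length (level n s) ≤ length (level n (suc s))
level-≤-level-suc {n} {s} n≥1 full =
  length-≤-injection raise (level n s) (level n (suc s)) (level-unique n s) raise-∈ raise-injective
  where open RaiseHead n≥1 full

-- Falling: lowering the fourth part

quad : ℕ → ℕ → ℕ → ℕ → List ℕ
quad a b c zero    = a ∷ b ∷ c ∷ []
quad a b c (suc d) = a ∷ b ∷ c ∷ suc d ∷ []

quad-Shape : ∀ {n a b c d} → 1 ≤ c → d < c → c < b → b < a → a ≤ n → Shape n (quad a b c d)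
quad-Shape {d = zero}  c≥1 _   c<b b<a a≤n = shape₃ c≥1 c<b b<a a≤n
quad-Shape {d = suc d} _   d<c c<b b<a a≤n = shape₄ (s≤s z≤n) d<c c<b b<a a≤n

quad-sum : ∀ a b c d → sum (quad a b c d) ≡ a + (b + (c + d))
quad-sum a b c zero    = refl
quad-sum a b c (suc d) = cong (λ t → a + (b + (c + t))) (+-identityʳ (suc d))

quad-injective : ∀ {a b c d a′ b′ c′ d′} → quad a b c d ≡ quad a′ b′ c′ d′ →
  a ≡ a′ × b ≡ b′ × c ≡ c′ × d ≡ d′
quad-injective {d = zero}  {d′ = zero}  refl = refl , refl , refl , refl
quad-injective {d = suc d} {d′ = suc d′} refl = refl , refl , refl , refl

quad-top : ∀ b c d → TopConsecutive (quad (suc b) b c d)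
quad-top b c zero    = refl
quad-top b c (suc d) = refl

quad-≢-pair : ∀ {a b c d x y} → quad a b c d ≢ x ∷ y ∷ []
quad-≢-pair {d = zero}  ()
quad-≢-pair {d = suc d} ()

BottomConsecutive : List ℕ → Set
BottomConsecutive (_ ∷ _ ∷ c ∷ [])     = c ≡ 1
BottomConsecutive (_ ∷ _ ∷ c ∷ d ∷ []) = c ≡ suc d
BottomConsecutive _                    = ⊥

quad-bottom : ∀ a b d → BottomConsecutive (quad a b (suc d) d)
quad-bottom a b zero    = refl
quad-bottom a b (suc d) = refl

bottom-quad : ∀ {a b c d} → BottomConsecutive (quad a b c d) → c ≡ suc d
bottom-quad {d = zero}  c≡1 = c≡1
bottom-quad {d = suc d} c≡  = c≡

lower-sum : ∀ a b c d → sum (a ∷ b ∷ c ∷ suc d ∷ []) ≡ suc (sum (quad a b c d))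
lower-sum a b c d = begin
  a + (b + (c + (suc d + 0))) ≡⟨ cong (λ t → a + (b + (c + t))) (+-identityʳ (suc d)) ⟩
  a + (b + (c + suc d))       ≡⟨ solve (a ∷ b ∷ c ∷ d ∷ []) ⟩
  suc (a + (b + (c + d)))     ≡⟨ cong suc (sym (quad-sum a b c d)) ⟩
  suc (sum (quad a b c d))    ∎
  where open ≡-Reasoning

lowered-¬bottom : ∀ {a b c d} → suc d < c → ¬ BottomConsecutive (quad a b c d)
lowered-¬bottom d+1<c bottom = <-irrefl (sym (bottom-quad bottom)) d+1<c

short-sum≤ : ∀ {n μ} → Shape n μ → length μ ≤ 2 → sum μ ≤ n + n
short-sum≤ shape₀           _ = z≤n
short-sum≤ (shape₁ _ a≤n)   _ = +-mono-≤ a≤n z≤n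
short-sum≤ {n} (shape₂ {b = b} _ b<a a≤n) _ =
  +-mono-≤ a≤n (subst (_≤ n) (sym (+-identityʳ b)) (<⇒≤ (<-≤-trans b<a a≤n)))
short-sum≤ (shape₃ _ _ _ _) (s≤s (s≤s ()))
short-sum≤ (shape₄ _ _ _ _ _) (s≤s (s≤s ()))

record TriplesToBottomConsecutive (n s : ℕ) : Set where
  field
    κ           : ℕ → ℕ → ℕ → List ℕ
    κ-∈         : ∀ {p q r} → p ∷ q ∷ r ∷ [] ∈ level n (suc s) → κ p q r ∈ level n s
    κ-bottom    : ∀ p q r → BottomConsecutive (κ p q r)
    κ-injective : ∀ {p q r p′ q′ r′} →
                  p ∷ q ∷ r ∷ [] ∈ level n (suc s) → p′ ∷ q′ ∷ r′ ∷ [] ∈ level n (suc s) →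
                  κ p q r ≡ κ p′ q′ r′ → p ∷ q ∷ r ∷ [] ≡ p′ ∷ q′ ∷ r′ ∷ []

module LowerLast {n s} (2n≤s : n + n ≤ s) (triples : TriplesToBottomConsecutive n s) where
  open TriplesToBottomConsecutive triples

  lower : List ℕ → List ℕ
  lower (a ∷ b ∷ c ∷ d ∷ []) = quad a b c (pred d)
  lower (p ∷ q ∷ r ∷ [])     = κ p q r
  lower _                    = []

  ¬short : ∀ {μ} → Shape n μ → sum μ ≡ suc s → ¬ length μ ≤ 2
  ¬short sh sum≡ ∣μ∣≤2 = 1+n≰n (≤-trans (≤-reflexive (sym sum≡)) (≤-trans (short-sum≤ sh ∣μ∣≤2) 2n≤s))

  lower-∈ : ∀ {μ} → μ ∈ level n (suc s) → lower μ ∈ level n s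
  lower-∈ μ∈ with ∈-level⁻ μ∈
  ... | sh@shape₀             , sum≡ = ⊥-elim (¬short sh sum≡ z≤n)
  ... | sh@(shape₁ _ _)       , sum≡ = ⊥-elim (¬short sh sum≡ (s≤s z≤n))
  ... | sh@(shape₂ _ _ _)     , sum≡ = ⊥-elim (¬short sh sum≡ (s≤s (s≤s z≤n)))
  ... | shape₃ _ _ _ _        , _    = κ-∈ μ∈
  ... | shape₄ {a} {b} {c} {suc d} _ d+1<c c<b b<a a≤n , sum≡ =
    ∈-level⁺ (quad-Shape (≤-trans (s≤s z≤n) d+1<c) (<-trans (n<1+n d) d+1<c) c<b b<a a≤n)
             (suc-injective (trans (sym (lower-sum a b c d)) sum≡))

  lower-injective : ∀ {μ μ′} → μ ∈ level n (suc s) → μ′ ∈ level n (suc s) → lower μ ≡ lower μ′ → μ ≡ μ′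
  lower-injective μ∈ μ′∈ eq with ∈-level⁻ μ∈ | ∈-level⁻ μ′∈
  ... | sh@shape₀         , sum≡ | _ = ⊥-elim (¬short sh sum≡ z≤n)
  ... | sh@(shape₁ _ _)   , sum≡ | _ = ⊥-elim (¬short sh sum≡ (s≤s z≤n))
  ... | sh@(shape₂ _ _ _) , sum≡ | _ = ⊥-elim (¬short sh sum≡ (s≤s (s≤s z≤n)))
  ... | _ | sh@shape₀         , sum≡ = ⊥-elim (¬short sh sum≡ z≤n)
  ... | _ | sh@(shape₁ _ _)   , sum≡ = ⊥-elim (¬short sh sum≡ (s≤s z≤n))
  ... | _ | sh@(shape₂ _ _ _) , sum≡ = ⊥-elim (¬short sh sum≡ (s≤s (s≤s z≤n)))
  ... | shape₃ _ _ _ _ , _ | shape₃ _ _ _ _ , _ = κ-injective μ∈ μ′∈ eq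
  ... | shape₃ {p} {q} {r} _ _ _ _ , _ | shape₄ {d = suc _} _ d<c _ _ _ , _ =
    ⊥-elim (lowered-¬bottom d<c (subst BottomConsecutive eq (κ-bottom p q r)))
  ... | shape₄ {d = suc _} _ d<c _ _ _ , _ | shape₃ {p} {q} {r} _ _ _ _ , _ =
    ⊥-elim (lowered-¬bottom d<c (subst BottomConsecutive (sym eq) (κ-bottom p q r)))
  ... | shape₄ {d = suc _} _ _ _ _ _ , _ | shape₄ {d = suc _} _ _ _ _ _ , _
    with refl , refl , refl , refl ← quad-injective eq = refl

level-suc-≤-level : ∀ {n s} → n + n ≤ s → TriplesToBottomConsecutive n s →
  length (level n (suc s)) ≤ length (level n s)
level-suc-≤-level {n} {s} 2n≤s triples =
  length-≤-injection lower (level n (suc s)) (level n s) (level-unique n (suc s)) lower-∈ lower-injective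
  where open LowerLast 2n≤s triples

record LevelTriple (n s p q r : ℕ) : Set where
  field
    r≥1  : 1 ≤ r
    r<q  : r < q
    q<p  : q < p
    p≤n  : p ≤ n
    sum≡ : p + (q + r) ≡ s

∈-level-triple⁻ : ∀ {n s p q r} → p ∷ q ∷ r ∷ [] ∈ level n s → LevelTriple n s p q r
∈-level-triple⁻ {p = p} {q} {r} t∈ with ∈-level⁻ t∈
... | shape₃ r≥1 r<q q<p p≤n , sum≡ = record
  { r≥1 = r≥1 ; r<q = r<q ; q<p = q<p ; p≤n = p≤n
  ; sum≡ = trans (cong (λ t → p + (q + t)) (sym (+-identityʳ r))) sum≡ }

module LowerTripleArithmetic {n e k p q r : ℕ} (e≤1 : e ≤ 1) (2n≤s : n + n ≤ e + (k + k))
  (triple : LevelTriple n (suc (e + (k + k))) p q r) where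
  open LevelTriple triple public
  open ≤-Reasoning

  n≤k : n ≤ k
  n≤k = m+m≤1+n+n⇒m≤n (≤-trans 2n≤s (+-monoˡ-≤ (k + k) e≤1))

  p≤1+n+q : p ≤ suc n + q
  p≤1+n+q = ≤-trans p≤n (≤-trans (n≤1+n n) (m≤m+n (suc n) q))

  e+n≤p+q : e + n ≤ p + q
  e+n≤p+q = +-cancelʳ-≤ r _ _ (begin
    e + n + r            ≤⟨ +-monoʳ-≤ (e + n) (<⇒≤ (<-trans r<q (<-≤-trans q<p p≤n))) ⟩
    e + n + n            ≡⟨ +-assoc e n n ⟩
    e + (n + n)          ≤⟨ +-monoʳ-≤ e 2n≤s ⟩
    e + (e + (k + k))    ≤⟨ +-monoˡ-≤ (e + (k + k)) e≤1 ⟩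
    suc (e + (k + k))    ≡⟨ sym sum≡ ⟩
    p + (q + r)          ≡⟨ +-assoc p q r ⟨
    p + q + r            ∎)

  1+q≤e+k : suc q ≤ e + k
  1+q≤e+k = m+m≤1+n+n⇒m≤n (begin
    suc q + suc q          ≡⟨ cong (suc q +_) (+-comm 1 q) ⟩
    suc q + (q + 1)        ≤⟨ +-mono-≤ q<p (+-monoʳ-≤ q r≥1) ⟩
    p + (q + r)            ≡⟨ sum≡ ⟩
    suc (e + (k + k))      ≤⟨ s≤s (m≤m+n (e + (k + k)) e) ⟩
    suc (e + (k + k) + e)  ≡⟨ cong suc (solve (e ∷ k ∷ [])) ⟩
    suc (e + k + (e + k))  ∎)

  1+n+q∸p≤n : suc n + q ∸ p ≤ n
  1+n+q∸p≤n = m≤n+o⇒m∸n≤o (suc n + q) p (begin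
    suc n + q  ≡⟨ solve (n ∷ q ∷ []) ⟩
    suc q + n  ≤⟨ +-monoˡ-≤ n q<p ⟩
    p + n      ∎)

  module ImageArithmetic (x y D : ℕ) (x+p≡ : x + p ≡ suc n + q) (y+e+n≡ : y + (e + n) ≡ p + q)
    (D+1+q≡ : D + suc q ≡ e + k) where

    y<x : y < x
    y<x = +-cancelʳ-≤ p _ _ (+-cancelʳ-≤ (e + n) _ _ (begin
      suc y + p + (e + n)        ≡⟨ solve (y ∷ p ∷ e ∷ n ∷ []) ⟩
      suc (y + (e + n)) + p      ≡⟨ cong (λ t → suc t + p) y+e+n≡ ⟩
      suc (p + q) + p            ≡⟨ solve (p ∷ q ∷ []) ⟩
      suc (q + (p + p))          ≤⟨ s≤s (+-monoʳ-≤ q (+-mono-≤ p≤n p≤n)) ⟩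
      suc (q + (n + n))          ≤⟨ m≤n+m _ e ⟩
      e + suc (q + (n + n))      ≡⟨ solve (e ∷ q ∷ n ∷ []) ⟩
      suc n + q + (e + n)        ≡⟨ cong (_+ (e + n)) x+p≡ ⟨
      x + p + (e + n)            ∎))

    1+D<y : suc D < y
    1+D<y = +-cancelʳ-≤ (e + n) _ _ (+-cancelʳ-≤ (suc q) _ _ (begin
      suc (suc D) + (e + n) + suc q  ≡⟨ solve (D ∷ e ∷ n ∷ q ∷ []) ⟩
      suc (suc (D + suc q)) + (e + n) ≡⟨ cong (λ t → suc (suc t) + (e + n)) D+1+q≡ ⟩
      suc (suc (e + k)) + (e + n)    ≤⟨ +-monoʳ-≤ (suc (suc (e + k))) (+-mono-≤ e≤1 n≤k) ⟩
      suc (suc (e + k)) + suc k      ≡⟨ solve (e ∷ k ∷ []) ⟩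
      suc (suc (suc (e + (k + k))))  ≡⟨ cong (λ t → suc (suc t)) sum≡ ⟨
      suc (suc (p + (q + r)))        ≤⟨ s≤s (+-monoʳ-< p (+-monoʳ-< q r<q)) ⟩
      suc (p + (q + q))              ≡⟨ solve (p ∷ q ∷ []) ⟩
      p + q + suc q                  ≡⟨ cong (_+ suc q) y+e+n≡ ⟨
      y + (e + n) + suc q            ∎))

    image-sum : x + (y + (suc D + D)) ≡ e + (k + k)
    image-sum = +-cancelʳ-≡ (p + (e + n) + suc (q + q)) _ _ (begin-equality
      x + (y + (suc D + D)) + (p + (e + n) + suc (q + q))
        ≡⟨ solve (x ∷ y ∷ D ∷ p ∷ e ∷ n ∷ q ∷ []) ⟩
      (x + p) + (y + (e + n)) + ((D + suc q) + (D + suc q))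
        ≡⟨ cong₂ _+_ (cong₂ _+_ x+p≡ y+e+n≡) (cong₂ _+_ D+1+q≡ D+1+q≡) ⟩
      (suc n + q) + (p + q) + ((e + k) + (e + k))
        ≡⟨ solve (n ∷ q ∷ p ∷ e ∷ k ∷ []) ⟩
      e + (k + k) + (p + (e + n) + suc (q + q))
        ∎)

  x+p≡ : (suc n + q ∸ p) + p ≡ suc n + q
  x+p≡ = m∸n+n≡m p≤1+n+q

  y+e+n≡ : (p + q ∸ (e + n)) + (e + n) ≡ p + q
  y+e+n≡ = m∸n+n≡m e+n≤p+q

  D+1+q≡ : (e + k ∸ suc q) + suc q ≡ e + k
  D+1+q≡ = m∸n+n≡m 1+q≤e+k

  open ImageArithmetic (suc n + q ∸ p) (p + q ∸ (e + n)) (e + k ∸ suc q) x+p≡ y+e+n≡ D+1+q≡ public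

-- A shape ⟨p, q, r⟩ of size s + 1 with s = e + 2k (e ≤ 1) goes to ⟨x, y, D + 1, D⟩ with x + p = n + 1 + q,
-- y + e + n = p + q and D + q + 1 = e + k. It has size s, (p, q) is recovered from (x, y), and r from the size.
lowerTriple : ℕ → ℕ → ℕ → ℕ → ℕ → List ℕ
lowerTriple n e k p q = quad (suc n + q ∸ p) (p + q ∸ (e + n)) (suc (e + k ∸ suc q)) (e + k ∸ suc q)

triplesToBottomConsecutive : ∀ {n e k} → e ≤ 1 → n + n ≤ e + (k + k) →
  TriplesToBottomConsecutive n (e + (k + k))
triplesToBottomConsecutive {n} {e} {k} e≤1 2n≤s = record
  { κ           = λ p q _ → lowerTriple n e k p q
  ; κ-∈         = lowerTriple-∈
  ; κ-bottom    = λ _ _ _ → quad-bottom _ _ _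
  ; κ-injective = lowerTriple-injective
  }
  where
  s : ℕ
  s = e + (k + k)

  lowerTriple-∈ : ∀ {p q r} → p ∷ q ∷ r ∷ [] ∈ level n (suc s) → lowerTriple n e k p q ∈ level n s
  lowerTriple-∈ {p} {q} t∈ =
    ∈-level⁺ (quad-Shape (s≤s z≤n) (n<1+n _) 1+D<y y<x 1+n+q∸p≤n)
             (trans (quad-sum (suc n + q ∸ p) (p + q ∸ (e + n)) (suc (e + k ∸ suc q)) (e + k ∸ suc q)) image-sum)
    where open LowerTripleArithmetic {k = k} e≤1 2n≤s (∈-level-triple⁻ t∈)

  lowerTriple-injective : ∀ {p q r p′ q′ r′} →
    p ∷ q ∷ r ∷ [] ∈ level n (suc s) → p′ ∷ q′ ∷ r′ ∷ [] ∈ level n (suc s) →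
    lowerTriple n e k p q ≡ lowerTriple n e k p′ q′ → p ∷ q ∷ r ∷ [] ≡ p′ ∷ q′ ∷ r′ ∷ []
  lowerTriple-injective {p} {q} {r} {p′} {q′} {r′} t∈ t′∈ eq
    with x≡x′ , y≡y′ , _ ← quad-injective eq =
    cong₂ _∷_ p≡p′ (cong₂ _∷_ q≡q′ (cong (_∷ []) r≡r′))
    where
    module T  = LowerTripleArithmetic {k = k} e≤1 2n≤s (∈-level-triple⁻ t∈)
    module T′ = LowerTripleArithmetic {k = k} e≤1 2n≤s (∈-level-triple⁻ t′∈)

    p≡p′×q≡q′ : p ≡ p′ × q ≡ q′
    p≡p′×q≡q′ = sums⇒≡
      (+-cancel-difference {suc n + q ∸ p} T.x+p≡ (trans (cong (_+ p′) x≡x′) T′.x+p≡))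
      (trans (sym T.y+e+n≡) (trans (cong (_+ (e + n)) y≡y′) T′.y+e+n≡))

    p≡p′ : p ≡ p′
    p≡p′ = proj₁ p≡p′×q≡q′

    q≡q′ : q ≡ q′
    q≡q′ = proj₂ p≡p′×q≡q′

    r≡r′ : r ≡ r′
    r≡r′ = +-cancelˡ-≡ q′ _ _ (+-cancelˡ-≡ p′ _ _
      (trans (cong₂ (λ a b → a + (b + r)) (sym p≡p′) (sym q≡q′)) (trans T.sum≡ (sym T′.sum≡))))

-- Encoding the shapes with largest part n

nth : ℕ → List ℕ → ℕ
nth _       []      = 0
nth zero    (x ∷ _) = x
nth (suc i) (_ ∷ r) = nth i r

data Tail (n s : ℕ) : ℕ → ℕ → Set where
  none : n ≤ s → Tail n s 0 0
  some : ∀ {b c d} → d < c → c < b → b < n → n + (b + (c + d)) ≡ s → Tail n s c d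

tail-view : ∀ {n s r} → n ∷ r ∈ level n s → Tail n s (nth 1 r) (nth 2 r)
tail-view {n} μ∈ with ∈-level⁻ μ∈
... | shape₁ _ _ , sum≡ = none (≤-reflexive (trans (sym (+-identityʳ _)) sum≡))
... | shape₂ {b = b} _ _ _ , sum≡ = none (≤-trans (m≤m+n _ (b + 0)) (≤-reflexive sum≡))
... | shape₃ c≥1 c<b b<n _ , sum≡ = some c≥1 c<b b<n sum≡
... | shape₄ {b = b} {c} {d} _ d<c c<b b<n _ , sum≡ =
  some d<c c<b b<n (trans (cong (λ t → n + (b + (c + t))) (sym (+-identityʳ d))) sum≡)

rest-determined : ∀ {n s r r′} → n ∷ r ∈ level n s → n ∷ r′ ∈ level n s →
  nth 1 r ≡ nth 1 r′ → nth 2 r ≡ nth 2 r′ → r ≡ r′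
rest-determined {n} μ∈ μ′∈ c≡c′ d≡d′ with ∈-level⁻ μ∈ | ∈-level⁻ μ′∈
... | shape₁ _ _ , _ | shape₁ _ _ , _ = refl
... | shape₁ _ _ , sum≡ | shape₂ b≥1 _ _ , sum′≡ =
  ⊥-elim (<⇒≢ b≥1 (trans (+-cancelˡ-≡ n _ _ (trans sum≡ (sym sum′≡))) (+-identityʳ _)))
... | shape₂ b≥1 _ _ , sum≡ | shape₁ _ _ , sum′≡ =
  ⊥-elim (<⇒≢ b≥1 (trans (+-cancelˡ-≡ n _ _ (trans sum′≡ (sym sum≡))) (+-identityʳ _)))
... | shape₂ _ _ _ , sum≡ | shape₂ _ _ _ , sum′≡ =
  cong (_∷ []) (+-cancelʳ-≡ 0 _ _ (+-cancelˡ-≡ n _ _ (trans sum≡ (sym sum′≡))))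
... | shape₁ _ _ , _ | shape₃ c≥1 _ _ _ , _ = ⊥-elim (<⇒≢ c≥1 c≡c′)
... | shape₁ _ _ , _ | shape₄ _ d<c _ _ _ , _ = ⊥-elim (<⇒≢ (≤-trans (s≤s z≤n) d<c) c≡c′)
... | shape₂ _ _ _ , _ | shape₃ c≥1 _ _ _ , _ = ⊥-elim (<⇒≢ c≥1 c≡c′)
... | shape₂ _ _ _ , _ | shape₄ _ d<c _ _ _ , _ = ⊥-elim (<⇒≢ (≤-trans (s≤s z≤n) d<c) c≡c′)
... | shape₃ c≥1 _ _ _ , _ | shape₁ _ _ , _ = ⊥-elim (<⇒≢ c≥1 (sym c≡c′))
... | shape₄ _ d<c _ _ _ , _ | shape₁ _ _ , _ = ⊥-elim (<⇒≢ (≤-trans (s≤s z≤n) d<c) (sym c≡c′))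
... | shape₃ c≥1 _ _ _ , _ | shape₂ _ _ _ , _ = ⊥-elim (<⇒≢ c≥1 (sym c≡c′))
... | shape₄ _ d<c _ _ _ , _ | shape₂ _ _ _ , _ = ⊥-elim (<⇒≢ (≤-trans (s≤s z≤n) d<c) (sym c≡c′))
... | shape₃ _ _ _ _ , _ | shape₄ d≥1 _ _ _ _ , _ = ⊥-elim (<⇒≢ d≥1 d≡d′)
... | shape₄ d≥1 _ _ _ _ , _ | shape₃ _ _ _ _ , _ = ⊥-elim (<⇒≢ d≥1 (sym d≡d′))
... | shape₃ _ _ _ _ , sum≡ | shape₃ _ _ _ _ , sum′≡
  rewrite c≡c′ =
  cong (λ b → b ∷ _ ∷ []) (+-cancelʳ-≡ _ _ _ (+-cancelˡ-≡ n _ _ (trans sum≡ (sym sum′≡))))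
... | shape₄ _ _ _ _ _ , sum≡ | shape₄ _ _ _ _ _ , sum′≡
  rewrite c≡c′ | d≡d′ =
  cong (λ b → b ∷ _ ∷ _ ∷ []) (+-cancelʳ-≡ _ _ _ (+-cancelˡ-≡ n _ _ (trans sum≡ (sym sum′≡))))

-- A shape ⟨n, b, c, d⟩ of size s = e + 2k (e ≤ 1, c ≥ 1, d = 0 if absent) goes to ⟨y + 1, y, z, g⟩ with
-- y + c = e + k, z + e = c + d + 1 and g + d + 1 = c. It has size s + 1, (c, d) is recovered from (z, g),
-- and b is then fixed by the size.
encodeTail : ℕ → ℕ → ℕ → ℕ → List ℕ
encodeTail e k c d = quad (suc (e + k ∸ c)) (e + k ∸ c) (suc (c + d) ∸ e) (c ∸ suc d)

module UpperImageArithmetic {n e k b c d : ℕ} (e≤1 : e ≤ 1) (k<n : k < n)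
  (d<c : d < c) (c<b : c < b) (b<n : b < n) (sum≡ : n + (b + (c + d)) ≡ e + (k + k)) where
  open ≤-Reasoning

  c≥1 : 1 ≤ c
  c≥1 = ≤-trans (s≤s z≤n) d<c

  rest<n : b + (c + d) < n
  rest<n = +-cancelˡ-< n _ _ (begin-strict
    n + (b + (c + d))  ≡⟨ sum≡ ⟩
    e + (k + k)        ≤⟨ +-monoˡ-≤ (k + k) e≤1 ⟩
    suc (k + k)        <⟨ s≤s (≤-reflexive (sym (+-suc k k))) ⟩
    suc k + suc k      ≤⟨ +-mono-≤ k<n k<n ⟩
    n + n              ∎)

  2c+d+2≤e+k : suc (suc (c + (c + d))) ≤ e + k
  2c+d+2≤e+k = m+m<n+n⇒m<n (begin-strict
    m + m                  ≤⟨ +-mono-≤ m≤rest m≤rest ⟩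
    rest + rest            <⟨ +-monoˡ-< rest rest<n ⟩
    n + rest               ≡⟨ sum≡ ⟩
    e + (k + k)            ≤⟨ m≤m+n (e + (k + k)) e ⟩
    e + (k + k) + e        ≡⟨ solve (e ∷ k ∷ []) ⟩
    e + k + (e + k)        ∎)
    where
    m rest : ℕ
    m    = suc (c + (c + d))
    rest = b + (c + d)
    m≤rest : m ≤ rest
    m≤rest = +-monoˡ-≤ (c + d) c<b

  module ImageArithmetic (y z g : ℕ) (y+c≡ : y + c ≡ e + k) (z+e≡ : z + e ≡ suc (c + d))
    (g+1+d≡ : g + suc d ≡ c) where

    c≤z : c ≤ z
    c≤z = m+n≤o⇒m≤o c (+-cancelʳ-≤ 1 _ _ (begin
      c + d + 1   ≡⟨ +-comm (c + d) 1 ⟩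
      suc (c + d) ≡⟨ z+e≡ ⟨
      z + e       ≤⟨ +-monoʳ-≤ z e≤1 ⟩
      z + 1       ∎))

    z≥1 : 1 ≤ z
    z≥1 = ≤-trans c≥1 c≤z

    g<z : g < z
    g<z = <-≤-trans (≤-trans (s≤s (m≤m+n g d)) (≤-reflexive (trans (sym (+-suc g d)) g+1+d≡))) c≤z

    z<y : z < y
    z<y = +-cancelʳ-≤ c _ _ (+-cancelʳ-≤ e _ _ (begin
      suc z + c + e                ≡⟨ solve (z ∷ c ∷ e ∷ []) ⟩
      suc (z + e) + c              ≡⟨ cong (λ t → suc t + c) z+e≡ ⟩
      suc (suc (c + d)) + c        ≡⟨ solve (c ∷ d ∷ []) ⟩
      suc (suc (c + (c + d)))      ≤⟨ 2c+d+2≤e+k ⟩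
      e + k                        ≤⟨ m≤m+n (e + k) e ⟩
      e + k + e                    ≡⟨ cong (_+ e) y+c≡ ⟨
      y + c + e                    ∎))

    1+y≤n : suc y ≤ n
    1+y≤n = +-cancelʳ-≤ c _ _ (begin
      suc y + c   ≡⟨ cong suc y+c≡ ⟩
      suc (e + k) ≡⟨ +-suc e k ⟨
      e + suc k   ≤⟨ +-mono-≤ (≤-trans e≤1 c≥1) k<n ⟩
      c + n       ≡⟨ +-comm c n ⟩
      n + c       ∎)

    image-sum : suc y + (y + (z + g)) ≡ suc (e + (k + k))
    image-sum = +-cancelʳ-≡ (c + c + e + suc d) _ _ (begin-equality
      suc y + (y + (z + g)) + (c + c + e + suc d)
        ≡⟨ solve (y ∷ z ∷ g ∷ c ∷ e ∷ d ∷ []) ⟩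
      suc ((y + c) + (y + c) + (z + e) + (g + suc d))
        ≡⟨ cong suc (cong₂ _+_ (cong₂ _+_ (cong₂ _+_ y+c≡ y+c≡) z+e≡) g+1+d≡) ⟩
      suc ((e + k) + (e + k) + suc (c + d) + c)
        ≡⟨ solve (e ∷ k ∷ c ∷ d ∷ []) ⟩
      suc (e + (k + k)) + (c + c + e + suc d)
        ∎)

    odd⇒2+z≤y : 1 ≤ e → suc (suc z) ≤ y
    odd⇒2+z≤y e≥1 = +-cancelʳ-≤ c _ _ (+-cancelʳ-≤ e _ _ (begin
      suc (suc z) + c + e              ≡⟨ solve (z ∷ c ∷ e ∷ []) ⟩
      suc (suc (z + e)) + c            ≡⟨ cong (λ t → suc (suc t) + c) z+e≡ ⟩
      suc (suc (suc (c + d))) + c      ≡⟨ solve (c ∷ d ∷ []) ⟩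
      suc (suc (suc (c + (c + d))))    ≤⟨ s≤s 2c+d+2≤e+k ⟩
      suc (e + k)                      ≡⟨ +-comm 1 (e + k) ⟩
      e + k + 1                        ≤⟨ +-monoʳ-≤ (e + k) e≥1 ⟩
      e + k + e                        ≡⟨ cong (_+ e) y+c≡ ⟨
      y + c + e                        ∎))

  y+c≡ : (e + k ∸ c) + c ≡ e + k
  y+c≡ = m∸n+n≡m (≤-trans (m≤m+n c (c + d)) (≤-trans (n≤1+n _) (≤-trans (n≤1+n _) 2c+d+2≤e+k)))

  z+e≡ : (suc (c + d) ∸ e) + e ≡ suc (c + d)
  z+e≡ = m∸n+n≡m (≤-trans e≤1 (s≤s z≤n))

  g+1+d≡ : (c ∸ suc d) + suc d ≡ c
  g+1+d≡ = m∸n+n≡m d<c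

  open ImageArithmetic (e + k ∸ c) (suc (c + d) ∸ e) (c ∸ suc d) y+c≡ z+e≡ g+1+d≡ public

  k≥4 : 5 ≤ n → 4 ≤ k
  k≥4 n≥5 = m+m≤1+n+n⇒m≤n (begin
    8                   ≤⟨ +-mono-≤ n≥5 (+-mono-≤ (≤-trans (s≤s c≥1) c<b) (+-mono-≤ c≥1 z≤n)) ⟩
    n + (b + (c + d))   ≡⟨ sum≡ ⟩
    e + (k + k)         ≤⟨ +-monoˡ-≤ (k + k) e≤1 ⟩
    suc (k + k)         ∎)

  encodeTail-∈ : encodeTail e k c d ∈ level n (suc (e + (k + k)))
  encodeTail-∈ = ∈-level⁺ (quad-Shape z≥1 g<z z<y (n<1+n _) 1+y≤n)
    (trans (quad-sum (suc (e + k ∸ c)) (e + k ∸ c) (suc (c + d) ∸ e) (c ∸ suc d)) image-sum)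

-- At odd sizes 2k + 1 the full shapes with at most two parts go to ⟨z + 2, z + 1, z, g⟩ with 3z + g = 2k − 1
-- and g < z, which encodeTail never reaches since its images have y ≥ z + 2 (odd⇒2+z≤y).
oddWitness : ℕ → List ℕ
oddWitness 3 = 4 ∷ 3 ∷ 1 ∷ []
oddWitness k = quad (2 + (k + k ∸ 1) / 3) (1 + (k + k ∸ 1) / 3) ((k + k ∸ 1) / 3) ((k + k ∸ 1) % 3)

oddWitness-top : ∀ k → TopConsecutive (oddWitness k)
oddWitness-top 0                           = refl
oddWitness-top 1                           = refl
oddWitness-top 2                           = refl
oddWitness-top 3                           = refl
oddWitness-top k@(suc (suc (suc (suc _)))) = quad-top _ _ ((k + k ∸ 1) % 3)

oddWitness-topThree : ∀ k → 4 ≤ k → ∃[ z ] ∃[ g ] oddWitness k ≡ quad (suc (suc z)) (suc z) z g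
oddWitness-topThree 0 ()
oddWitness-topThree 1 (s≤s ())
oddWitness-topThree 2 (s≤s (s≤s ()))
oddWitness-topThree 3 (s≤s (s≤s (s≤s ())))
oddWitness-topThree (suc (suc (suc (suc _)))) _ = _ , _ , refl

oddWitness-arithmetic : ∀ {k z g} → 5 ≤ k → g + z * 3 + 1 ≡ k + k →
  2 + z ≤ k × 2 + z + (1 + z + (z + g)) ≡ suc (suc (k + k))
oddWitness-arithmetic {k} {z} {g} k≥5 w+1≡ = *-cancelʳ-≤ (2 + z) k 3 (begin
    (2 + z) * 3           ≡⟨ solve (z ∷ []) ⟩
    6 + z * 3             ≤⟨ +-monoʳ-≤ 6 (m≤n+m (z * 3) g) ⟩
    6 + (g + z * 3)       ≡⟨ solve (g ∷ z ∷ []) ⟩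
    5 + (g + z * 3 + 1)   ≡⟨ cong (5 +_) w+1≡ ⟩
    5 + (k + k)           ≤⟨ +-monoˡ-≤ (k + k) k≥5 ⟩
    k + (k + k)           ≡⟨ solve (k ∷ []) ⟩
    k * 3                 ∎)
  , (begin-equality
    2 + z + (1 + z + (z + g))  ≡⟨ solve (z ∷ g ∷ []) ⟩
    2 + (g + z * 3 + 1)        ≡⟨ cong (2 +_) w+1≡ ⟩
    2 + (k + k)                ∎)
  where open ≤-Reasoning

oddWitness-∈ : ∀ {n k} → 2 ≤ k → k < n → oddWitness k ∈ level n (suc (suc (k + k)))
oddWitness-∈ {k = 1} (s≤s ()) _
oddWitness-∈ {k = 2} _ k<n = ∈-level⁺ (shape₃ ≤-refl (s≤s ≤-refl) (s≤s (s≤s ≤-refl)) k<n) refl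
oddWitness-∈ {k = 3} _ k<n = ∈-level⁺ (shape₃ ≤-refl (s≤s (s≤s z≤n)) (s≤s (s≤s (s≤s ≤-refl))) k<n) refl
oddWitness-∈ {k = 4} _ k<n =
  ∈-level⁺ (shape₄ ≤-refl (s≤s ≤-refl) (s≤s (s≤s ≤-refl)) (s≤s (s≤s (s≤s ≤-refl))) (<⇒≤ k<n)) refl
oddWitness-∈ {n} {k@(suc (suc (suc (suc (suc _)))))} _ k<n =
  ∈-level⁺ (quad-Shape (≤-trans (s≤s z≤n) 3≤z) (<-≤-trans (m%n<n w 3) 3≤z) (n<1+n z) (n<1+n (suc z))
                       (≤-trans (proj₁ corner) (<⇒≤ k<n)))
           (trans (quad-sum (2 + z) (1 + z) z g) (proj₂ corner))
  where
  w z g : ℕ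
  w = k + k ∸ 1
  z = w / 3
  g = w % 3

  k≥5 : 5 ≤ k
  k≥5 = s≤s (s≤s (s≤s (s≤s (s≤s z≤n))))

  3≤z : 3 ≤ z
  3≤z = /-monoˡ-≤ 3 (∸-monoˡ-≤ 1 (+-mono-≤ k≥5 k≥5))

  corner : 2 + z ≤ k × 2 + z + (1 + z + (z + g)) ≡ suc (suc (k + k))
  corner = oddWitness-arithmetic k≥5
    (trans (cong (_+ 1) (sym (m≡m%n+[m/n]*n w 3))) (m∸n+n≡m (s≤s z≤n)))

shortFullImage : ℕ → ℕ → List ℕ
shortFullImage zero    k = suc k ∷ k ∷ []
shortFullImage (suc _) k = oddWitness k

fullImage : ℕ → ℕ → ℕ → ℕ → List ℕ
fullImage e k zero      _ = shortFullImage e k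
fullImage e k c@(suc _) d = encodeTail e k c d

fullImage-top : ∀ e k c d → TopConsecutive (fullImage e k c d)
fullImage-top zero    k zero      _ = refl
fullImage-top (suc _) k zero      _ = oddWitness-top k
fullImage-top e       k c@(suc _) d = quad-top _ _ (c ∸ suc d)

5≤e+k+k⇒2≤k : ∀ {e k} → e ≤ 1 → 5 ≤ e + (k + k) → 2 ≤ k
5≤e+k+k⇒2≤k {k = k} e≤1 5≤s = m+m≤1+n+n⇒m≤n (≤-trans (n≤1+n 4) (≤-trans 5≤s (+-monoˡ-≤ (k + k) e≤1)))

shortFullImage-∈ : ∀ {n e k} → 5 ≤ n → e ≤ 1 → k < n → n ≤ e + (k + k) →
  shortFullImage e k ∈ level n (suc (e + (k + k)))
shortFullImage-∈ {e = zero} {k} n≥5 e≤1 k<n n≤s =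
  ∈-level⁺ (shape₂ (≤-trans (s≤s z≤n) (5≤e+k+k⇒2≤k e≤1 (≤-trans n≥5 n≤s))) (n<1+n k) k<n)
           (cong (λ t → suc (k + t)) (+-identityʳ k))
shortFullImage-∈ {e = suc zero} n≥5 e≤1 k<n n≤s = oddWitness-∈ (5≤e+k+k⇒2≤k e≤1 (≤-trans n≥5 n≤s)) k<n
shortFullImage-∈ {e = suc (suc _)} _ (s≤s ()) _ _

shortFullImage≢encodeTail : ∀ {n e k b c d} → 5 ≤ n → e ≤ 1 → k < n →
  d < c → c < b → b < n → n + (b + (c + d)) ≡ e + (k + k) → shortFullImage e k ≢ encodeTail e k c d
shortFullImage≢encodeTail {e = zero} _ _ _ _ _ _ _ eq = quad-≢-pair (sym eq)
shortFullImage≢encodeTail {e = suc zero} {k} n≥5 e≤1 k<n d<c c<b b<n sum≡ eq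
  with z , g , witness≡ ← oddWitness-topThree k (UpperImageArithmetic.k≥4 e≤1 k<n d<c c<b b<n sum≡ n≥5)
  with _ , y≡ , z≡ , _ ← quad-injective (trans (sym witness≡) eq) =
  1+n≰n (subst₂ (λ a b → suc (suc a) ≤ b) (sym z≡) (sym y≡) (odd⇒2+z≤y (s≤s z≤n)))
  where open UpperImageArithmetic e≤1 k<n d<c c<b b<n sum≡
shortFullImage≢encodeTail {e = suc (suc _)} _ (s≤s ()) _ _ _ _ _ _

module FullImage {n e k : ℕ} (n≥5 : 5 ≤ n) (e≤1 : e ≤ 1) (k<n : k < n) where
  s : ℕ
  s = e + (k + k)

  fullImage-∈ : ∀ {c d} → Tail n s c d → fullImage e k c d ∈ level n (suc s)
  fullImage-∈ (none n≤s) = shortFullImage-∈ n≥5 e≤1 k<n n≤s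
  fullImage-∈ (some d<c@(s≤s _) c<b b<n sum≡) = encodeTail-∈
    where open UpperImageArithmetic e≤1 k<n d<c c<b b<n sum≡

  fullImage-injective : ∀ {c d c′ d′} → Tail n s c d → Tail n s c′ d′ →
    fullImage e k c d ≡ fullImage e k c′ d′ → c ≡ c′ × d ≡ d′
  fullImage-injective (none _) (none _) _ = refl , refl
  fullImage-injective (none _) (some d<c@(s≤s _) c<b b<n sum≡) eq =
    ⊥-elim (shortFullImage≢encodeTail n≥5 e≤1 k<n d<c c<b b<n sum≡ eq)
  fullImage-injective (some d<c@(s≤s _) c<b b<n sum≡) (none _) eq =
    ⊥-elim (shortFullImage≢encodeTail n≥5 e≤1 k<n d<c c<b b<n sum≡ (sym eq))
  fullImage-injective {c} {d} {c′} {d′}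
    (some d<c@(s≤s _) c<b b<n sum≡) (some d′<c′@(s≤s _) c′<b′ b′<n sum′≡) eq
    with _ , _ , z≡z′ , g≡g′ ← quad-injective eq =
    swap (sums⇒≡ {d} {c} {d′} {c′} (suc-injective cross) same)
    where
    module A = UpperImageArithmetic e≤1 k<n d<c c<b b<n sum≡
    module B = UpperImageArithmetic e≤1 k<n d′<c′ c′<b′ b′<n sum′≡

    cross : suc d + c′ ≡ suc d′ + c
    cross = +-cancel-difference {c ∸ suc d} {0} {suc d} {c} {suc d′} {c′}
      A.g+1+d≡ (trans (cong (_+ suc d′) g≡g′) B.g+1+d≡)

    same : d + c ≡ d′ + c′
    same = trans (+-comm d c) (trans (suc-injective (trans (sym A.z+e≡) (trans (cong (_+ e) z≡z′) B.z+e≡)))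
                                     (+-comm c′ d′))

fullToTopConsecutive : ∀ {n e k} → 5 ≤ n → e ≤ 1 → k < n → FullToTopConsecutive n (e + (k + k))
fullToTopConsecutive {n} {e} {k} n≥5 e≤1 k<n = record
  { ψ           = λ r → fullImage e k (nth 1 r) (nth 2 r)
  ; ψ-∈         = λ μ∈ → fullImage-∈ (tail-view μ∈)
  ; ψ-top       = λ r → fullImage-top e k (nth 1 r) (nth 2 r)
  ; ψ-injective = λ μ∈ μ′∈ eq →
      let c≡c′ , d≡d′ = fullImage-injective (tail-view μ∈) (tail-view μ′∈) eq
      in  rest-determined μ∈ μ′∈ c≡c′ d≡d′
  }
  where open FullImage n≥5 e≤1 k<n

parity : ∀ s → ∃[ k ] ∃[ e ] e ≤ 1 × s ≡ e + (k + k)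
parity zero          = 0 , 0 , z≤n , refl
parity (suc zero)    = 0 , 1 , s≤s z≤n , refl
parity (suc (suc s)) with k , e , e≤1 , refl ← parity s = suc k , e , e≤1 , solve (e ∷ k ∷ [])

rankCoeff-rising : ∀ {n s} → 5 ≤ n → s < n + n →
  rankCoeff (staircase n) s ≤ rankCoeff (staircase n) (suc s)
rankCoeff-rising {n} {s} n≥5 s<2n with k , e , e≤1 , refl ← parity s =
  subst₂ _≤_ (sym (rankCoeff-staircase n s)) (sym (rankCoeff-staircase n (suc s)))
    (level-≤-level-suc (≤-trans (s≤s z≤n) n≥5) (fullToTopConsecutive n≥5 e≤1 k<n))
  where
  k<n : k < n
  k<n = m+m<n+n⇒m<n (≤-<-trans (m≤n+m (k + k) e) s<2n)

rankCoeff-falling : ∀ {n s} → n + n ≤ s →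
  rankCoeff (staircase n) (suc s) ≤ rankCoeff (staircase n) s
rankCoeff-falling {n} {s} 2n≤s with k , e , e≤1 , refl ← parity s =
  subst₂ _≤_ (sym (rankCoeff-staircase n (suc s))) (sym (rankCoeff-staircase n s))
    (level-suc-≤-level 2n≤s (triplesToBottomConsecutive {n} {e} {k} e≤1 2n≤s))

unimodal-staircase-≥5 : ∀ {n} → 5 ≤ n → Unimodal (rankCoeff (staircase n))
unimodal-staircase-≥5 {n} n≥5 = n + n , (λ _ → rankCoeff-rising n≥5) , (λ _ → rankCoeff-falling {n})

-- The coefficients are 1, 1, 1, 2, 2, 2, 2, 2, 1, 1, 1.
unimodal-staircase-4 : Unimodal (rankCoeff (staircase 4))
unimodal-staircase-4 = 3 , rising , falling
  where
  c : ℕ → ℕ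
  c = rankCoeff (staircase 4)

  rising : ∀ i → i < 3 → c i ≤ c (suc i)
  rising 0 _ = ≤ᵇ⇒≤ (c 0) (c 1) tt
  rising 1 _ = ≤ᵇ⇒≤ (c 1) (c 2) tt
  rising 2 _ = ≤ᵇ⇒≤ (c 2) (c 3) tt
  rising (suc (suc (suc _))) (s≤s (s≤s (s≤s ())))

  falling : ∀ i → 3 ≤ i → c (suc i) ≤ c i
  falling 0 ()
  falling 1 (s≤s ())
  falling 2 (s≤s (s≤s ()))
  falling 3 _ = ≤ᵇ⇒≤ (c 4) (c 3) tt
  falling 4 _ = ≤ᵇ⇒≤ (c 5) (c 4) tt
  falling 5 _ = ≤ᵇ⇒≤ (c 6) (c 5) tt
  falling 6 _ = ≤ᵇ⇒≤ (c 7) (c 6) tt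
  falling 7 _ = ≤ᵇ⇒≤ (c 8) (c 7) tt
  falling i@(suc (suc (suc (suc (suc (suc (suc (suc j)))))))) _ = rankCoeff-falling {4} {i} (m≤m+n 8 j)

theorem2p4 : (n : ℕ) → 4 ≤ n →
    Unimodal (rankCoeff (n ∷ (n ∸ 1) ∷ (n ∸ 2) ∷ (n ∸ 3) ∷ []))
theorem2p4 n 4≤n with m≤n⇒m<n∨m≡n 4≤n
... | inj₁ 4<n  = unimodal-staircase-≥5 4<n
... | inj₂ refl = unimodal-staircase-4
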